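{- Fix a prime $p$ and integers $0\le a\le b$. For $0\le c\le b-a$ and $e\in\mathbb{Z}_{p^c}^*$, let $\mathcal{A}(p;a,b,c,e)$ be the regular dessin $(G,x,y)$ with $G=\langle x,y\mid x^{p^b}=y^{p^{a+c}}=[x,y]=1,\ y^{p^a}=x^{ep^{b-c}}\rangle$. Then two dessins $\mathcal{A}(p;a,b,c_1,e_1)$ and $\mathcal{A}(p;a,b,c_2,e_2)$ lie in the same orbit under the generalised Wilson operations if and only if $c_1=c_2$. In particular, each such dessin is invariant (up to isomorphism) under every Wilson operation.
   Context: A regular dessin is a triple $(G,x,y)$ with $G$ a finite group generated by $x,y$; $(G_1,x_1,y_1)\cong(G_2,x_2,y_2)$ if $x_1\mapsto x_2$, $y_1\mapsto y_2$ extends to a group isomorphism. For integers $i,j$ with $\gcd(i,o(x))=\gcd(j,o(y))=1$, the generalised Wilson operation $H_{i,j}$ sends $(G,x,y)$ to $(G,x^i,y^j)$; two dessins lie in the same orbit if one is isomorphic to the image of the other under some $H_{i,j}$. The Wilson operation $H_j$ is $H_{j,j}$. -}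

module Defs where

open import Level using (0ℓ)
open import Algebra.Bundles using (Group)
open import Algebra.Morphism.Structures using (module GroupMorphisms)
open import Data.Nat using (ℕ; zero; suc; _<_; _∸_; _+_; _*_; _^_)
open import Data.Nat.Coprimality using (Coprime)
open import Data.Integer using (ℤ; +_; -[1+_]; ∣_∣)
open import Data.Product using (Σ; ∃; _×_; _,_)
open import Data.Sum using (_⊎_)
open import Data.List using (List; []; _∷_)
open import Data.List.Membership.Propositional using (_∈_)
open import Relation.Nullary using (¬_)
open import Relation.Binary.PropositionalEquality using (_≡_)

module _ (G : Group 0ℓ 0ℓ) where
  open Group G

  pow : Carrier → ℕ → Carrier
  pow x zero    = ε
  pow x (suc n) = x ∙ pow x n

  powℤ : Carrier → ℤ → Carrier
  powℤ x (+ n)      = pow x n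
  powℤ x -[1+ n ]   = (pow x (suc n)) ⁻¹

  IsOrder : Carrier → ℕ → Set
  IsOrder x n = (0 < n) × (pow x n ≈ ε) × (∀ m → 0 < m → m < n → ¬ (pow x m ≈ ε))

infixl 7 _·_
infix 8 _⁻

data Word : Set where
  wx wy we : Word
  _·_      : Word → Word → Word
  _⁻       : Word → Word

module _ (G : Group 0ℓ 0ℓ) where
  open Group G

  evalWord : Carrier → Carrier → Word → Carrier
  evalWord x y wx      = x
  evalWord x y wy      = y
  evalWord x y we      = ε
  evalWord x y (w · v) = evalWord x y w ∙ evalWord x y v
  evalWord x y (w ⁻)   = (evalWord x y w) ⁻¹

  Generates : Carrier → Carrier → Set
  Generates x y = ∀ g → ∃ λ w → evalWord x y w ≈ g

record Dessin : Set₁ where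
  field
    G   : Group 0ℓ 0ℓ
    x   : Group.Carrier G
    y   : Group.Carrier G
    gen : Generates G x y

-- Stated for arbitrary triples (not necessarily generating pairs), since the
-- image of a dessin under H_{i,j} is again just a triple (G, x^i, y^j).
TripleIso : (G₁ : Group 0ℓ 0ℓ) → Group.Carrier G₁ → Group.Carrier G₁ →
            (G₂ : Group 0ℓ 0ℓ) → Group.Carrier G₂ → Group.Carrier G₂ → Set
TripleIso G₁ x₁ y₁ G₂ x₂ y₂ =
  Σ (Group.Carrier G₁ → Group.Carrier G₂) λ f →
    GroupMorphisms.IsGroupIsomorphism (Group.rawGroup G₁) (Group.rawGroup G₂) f
    × Group._≈_ G₂ (f x₁) x₂ × Group._≈_ G₂ (f y₁) y₂

_≅_ : Dessin → Dessin → Set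
D₁ ≅ D₂ = TripleIso (Dessin.G D₁) (Dessin.x D₁) (Dessin.y D₁)
                    (Dessin.G D₂) (Dessin.x D₂) (Dessin.y D₂)

CoprimeToOrder : (G : Group 0ℓ 0ℓ) → Group.Carrier G → ℤ → Set
CoprimeToOrder G x i = ∃ λ n → IsOrder G x n × Coprime ∣ i ∣ n

HImageIso : ℤ → ℤ → Dessin → Dessin → Set
HImageIso i j D D' =
  CoprimeToOrder (Dessin.G D) (Dessin.x D) i ×
  CoprimeToOrder (Dessin.G D) (Dessin.y D) j ×
  TripleIso (Dessin.G D) (powℤ (Dessin.G D) (Dessin.x D) i) (powℤ (Dessin.G D) (Dessin.y D) j)
            (Dessin.G D') (Dessin.x D') (Dessin.y D')

SameOrbit : Dessin → Dessin → Set
SameOrbit D₁ D₂ = ∃ λ i → ∃ λ j → HImageIso i j D₁ D₂ ⊎ HImageIso i j D₂ D₁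

WilsonInvariant : Dessin → Set
WilsonInvariant D = ∀ (j : ℤ) →
  CoprimeToOrder (Dessin.G D) (Dessin.x D) j →
  CoprimeToOrder (Dessin.G D) (Dessin.y D) j →
  TripleIso (Dessin.G D) (powℤ (Dessin.G D) (Dessin.x D) j) (powℤ (Dessin.G D) (Dessin.y D) j)
            (Dessin.G D) (Dessin.x D) (Dessin.y D)

wpow : Word → ℕ → Word
wpow w zero    = we
wpow w (suc n) = w · wpow w n

module Presentation (R : List (Word × Word)) where

  infix 4 _≈ᴾ_
  data _≈ᴾ_ : Word → Word → Set where
    ≈-refl  : ∀ {w} → w ≈ᴾ w
    ≈-sym   : ∀ {w v} → w ≈ᴾ v → v ≈ᴾ w
    ≈-trans : ∀ {u v w} → u ≈ᴾ v → v ≈ᴾ w → u ≈ᴾ w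
    ·-cong  : ∀ {w w' v v'} → w ≈ᴾ w' → v ≈ᴾ v' → w · v ≈ᴾ w' · v'
    ⁻-cong  : ∀ {w w'} → w ≈ᴾ w' → w ⁻ ≈ᴾ w' ⁻
    assoc   : ∀ u v w → (u · v) · w ≈ᴾ u · (v · w)
    idˡ     : ∀ w → we · w ≈ᴾ w
    idʳ     : ∀ w → w · we ≈ᴾ w
    invˡ    : ∀ w → w ⁻ · w ≈ᴾ we
    invʳ    : ∀ w → w · w ⁻ ≈ᴾ we
    rel     : ∀ {l r} → (l , r) ∈ R → l ≈ᴾ r

  group : Group 0ℓ 0ℓ
  group = record
    { Carrier = Word
    ; _≈_ = _≈ᴾ_
    ; _∙_ = _·_
    ; ε = we
    ; _⁻¹ = _⁻
    ; isGroup = record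
      { isMonoid = record
        { isSemigroup = record
          { isMagma = record
            { isEquivalence = record { refl = ≈-refl ; sym = ≈-sym ; trans = ≈-trans }
            ; ∙-cong = ·-cong }
          ; assoc = assoc }
        ; identity = idˡ , idʳ }
      ; inverse = invˡ , invʳ
      ; ⁻¹-cong = ⁻-cong }
    }

  evalWord-id : ∀ w → evalWord group wx wy w ≡ w
  evalWord-id wx = Relation.Binary.PropositionalEquality.refl
  evalWord-id wy = Relation.Binary.PropositionalEquality.refl
  evalWord-id we = Relation.Binary.PropositionalEquality.refl
  evalWord-id (w · v) = Relation.Binary.PropositionalEquality.cong₂ _·_ (evalWord-id w) (evalWord-id v)
  evalWord-id (w ⁻) = Relation.Binary.PropositionalEquality.cong _⁻ (evalWord-id w)

  generates : Generates group wx wy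
  generates g = g , Relation.Binary.PropositionalEquality.subst (_≈ᴾ g)
                      (Relation.Binary.PropositionalEquality.sym (evalWord-id g)) ≈-refl

  dessin : Dessin
  dessin = record { G = group ; x = wx ; y = wy ; gen = generates }

-- The dessin A(p; a, b, c, e):
--   G = ⟨x, y | x^{p^b} = y^{p^{a+c}} = [x,y] = 1, y^{p^a} = x^{e p^{b-c}}⟩
-- with [x,y] = x⁻¹ y⁻¹ x y.  (Natural subtraction b ∸ c is genuine
-- subtraction under the standing hypothesis c ≤ b - a.)

A-relations : ℕ → ℕ → ℕ → ℕ → ℕ → List (Word × Word)
A-relations p a b c e =
    (wpow wx (p ^ b) , we)
  ∷ (wpow wy (p ^ (a + c)) , we)
  ∷ (wx ⁻ · wy ⁻ · wx · wy , we)
  ∷ (wpow wy (p ^ a) , wpow wx (e * p ^ (b ∸ c)))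
  ∷ []

𝒜 : ℕ → ℕ → ℕ → ℕ → ℕ → Dessin
𝒜 p a b c e = Presentation.dessin (A-relations p a b c e)

-- Write G_e for the group of 𝒜(p; a, b, c, e).  It is generated by the
-- commuting elements x and y, hence abelian, and it has exponent pᵇ.  Its
-- generators have periods o(x) = pᵇ and o(y) = p^{a+c}: the upper bounds are
-- defining relations, the lower bounds come from homomorphisms into cyclic
-- groups ℤ/M supplied by the universal property of the presentation.  Then:
--  * Wilson invariance: in an abelian group of exponent N, powering by j
--    prime to N is an automorphism, so (G, xʲ, yʲ) ≅ (G, x, y).
--  * c is an orbit invariant: an isomorphism H_{i,j}(𝒜₁) ≅ 𝒜₂ sends yʲ to y,
--    and yʲ has the same period p^{a+c₁} as y, so p^{a+c₁} = p^{a+c₂}.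
--  * Equal c suffices: for j ≡ e₂/e₁ (mod pᶜ) prime to p, the substitutions
--    y ↦ yʲ and y ↦ y^{1/j} are mutually inverse isomorphisms between the
--    presentations, realising H_{1,j}(𝒜(p;a,b,c,e₁)) ≅ 𝒜(p;a,b,c,e₂).

module Submission where

open import Defs
open import Data.Nat using (ℕ; _≤_; _<_; _∸_; _^_)
open import Data.Nat.Coprimality using (Coprime)
open import Data.Nat.Primality using (Prime)
open import Data.Product using (_×_)
open import Function.Bundles using (_⇔_)
open import Relation.Binary.PropositionalEquality using (_≡_)

open import Level using (0ℓ)
open import Algebra.Bundles using (Group)
open import Algebra.Morphism.Structures using (module GroupMorphisms)
open import Data.Nat using (zero; suc; _+_; _*_; _%_; NonZero)
open import Data.Nat.Divisibility using (_∣_; divides; divides-refl)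
open import Data.Nat.DivMod using (m≡m%n+[m/n]*n)
open import Data.Nat.Properties using (*-comm; +-comm)
open import Data.Product using (∃; _,_; proj₁; proj₂)
open import Data.List using (List)
open import Data.List.Membership.Propositional using (_∈_)
open import Data.List.Relation.Unary.Any using (here; there)
import Relation.Binary.PropositionalEquality as ≡
open import Data.Integer using (+_)

module PowerLaws (G : Group 0ℓ 0ℓ) where
  open Group G
  open import Algebra.Properties.Group G using (ε⁻¹≈ε; ⁻¹-anti-homo-∙)
  open import Relation.Binary.Reasoning.Setoid setoid

  infixr 8 _^ᴳ_
  _^ᴳ_ : Carrier → ℕ → Carrier
  _^ᴳ_ = pow G

  pow-cong : ∀ {g h} n → g ≈ h → g ^ᴳ n ≈ h ^ᴳ n
  pow-cong zero    g≈h = refl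
  pow-cong (suc n) g≈h = ∙-cong g≈h (pow-cong n g≈h)

  pow-≡ : ∀ g {m n} → m ≡ n → g ^ᴳ m ≈ g ^ᴳ n
  pow-≡ g ≡.refl = refl

  pow-one : ∀ g → g ^ᴳ 1 ≈ g
  pow-one = identityʳ

  pow-ε : ∀ n → ε ^ᴳ n ≈ ε
  pow-ε zero    = refl
  pow-ε (suc n) = trans (identityˡ _) (pow-ε n)

  pow-+ : ∀ g m n → g ^ᴳ (m + n) ≈ g ^ᴳ m ∙ g ^ᴳ n
  pow-+ g zero    n = sym (identityˡ _)
  pow-+ g (suc m) n = trans (∙-congˡ (pow-+ g m n)) (sym (assoc _ _ _))

  pow-* : ∀ g m n → g ^ᴳ (m * n) ≈ (g ^ᴳ n) ^ᴳ m
  pow-* g zero    n = refl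
  pow-* g (suc m) n = trans (pow-+ g n (m * n)) (∙-congˡ (pow-* g m n))

  pow-pow-comm : ∀ g m n → (g ^ᴳ m) ^ᴳ n ≈ (g ^ᴳ n) ^ᴳ m
  pow-pow-comm g m n = trans (sym (pow-* g n m)) (trans (pow-≡ g (*-comm n m)) (pow-* g m n))

  -- a power of g commutes with g; this makes (g⁻¹)ⁿ the inverse of gⁿ
  pow-suc-comm : ∀ g n → g ∙ g ^ᴳ n ≈ g ^ᴳ n ∙ g
  pow-suc-comm g n = trans (pow-≡ g (+-comm 1 n)) (trans (pow-+ g n 1) (∙-congˡ (pow-one g)))

  pow-⁻¹ : ∀ g n → (g ⁻¹) ^ᴳ n ≈ (g ^ᴳ n) ⁻¹
  pow-⁻¹ g zero    = sym ε⁻¹≈ε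
  pow-⁻¹ g (suc n) = begin
    g ⁻¹ ∙ (g ⁻¹) ^ᴳ n  ≈⟨ ∙-congˡ (pow-⁻¹ g n) ⟩
    g ⁻¹ ∙ (g ^ᴳ n) ⁻¹  ≈⟨ ⁻¹-anti-homo-∙ (g ^ᴳ n) g ⟨
    (g ^ᴳ n ∙ g) ⁻¹     ≈⟨ ⁻¹-cong (pow-suc-comm g n) ⟨
    (g ∙ g ^ᴳ n) ⁻¹     ∎

  pow-multiple : ∀ g {N m} → g ^ᴳ N ≈ ε → N ∣ m → g ^ᴳ m ≈ ε
  pow-multiple g {N} gᴺ≈ε (divides-refl q) =
    trans (pow-* g q N) (trans (pow-cong q gᴺ≈ε) (pow-ε q))

  pow-mod : ∀ g N .{{_ : NonZero N}} → g ^ᴳ N ≈ ε → ∀ u → g ^ᴳ u ≈ g ^ᴳ (u % N)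
  pow-mod g N gᴺ≈ε u = begin
    g ^ᴳ u                                ≈⟨ pow-≡ g (m≡m%n+[m/n]*n u N) ⟩
    g ^ᴳ (u % N + (u / N) * N)            ≈⟨ pow-+ g (u % N) _ ⟩
    g ^ᴳ (u % N) ∙ g ^ᴳ ((u / N) * N)     ≈⟨ ∙-congˡ (pow-multiple g gᴺ≈ε (divides-refl (u / N))) ⟩
    g ^ᴳ (u % N) ∙ ε                      ≈⟨ identityʳ _ ⟩
    g ^ᴳ (u % N)                          ∎
    where open import Data.Nat using (_/_)

  pow-congruent : ∀ g N .{{_ : NonZero N}} → g ^ᴳ N ≈ ε →
                  ∀ {u v} → u % N ≡ v % N → g ^ᴳ u ≈ g ^ᴳ v
  pow-congruent g N gᴺ≈ε {u} {v} u≡v =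
    trans (pow-mod g N gᴺ≈ε u) (trans (pow-≡ g u≡v) (sym (pow-mod g N gᴺ≈ε v)))

  pow-inverse : ∀ g N .{{_ : NonZero N}} → g ^ᴳ N ≈ ε →
                ∀ s k → (s * k) % N ≡ 1 % N → (g ^ᴳ s) ^ᴳ k ≈ g
  pow-inverse g N gᴺ≈ε s k sk≡1 = begin
    (g ^ᴳ s) ^ᴳ k  ≈⟨ pow-* g k s ⟨
    g ^ᴳ (k * s)   ≈⟨ pow-congruent g N gᴺ≈ε (≡.trans (≡.cong (_% N) (*-comm k s)) sk≡1) ⟩
    g ^ᴳ 1         ≈⟨ pow-one g ⟩
    g              ∎

module Commutation (G : Group 0ℓ 0ℓ) where
  open Group G
  open import Algebra.Properties.Group G using (⁻¹-anti-homo-∙; ⁻¹-involutive; inverseʳ-unique)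
  open import Relation.Binary.Reasoning.Setoid setoid

  Commutes : Carrier → Carrier → Set
  Commutes g h = g ∙ h ≈ h ∙ g

  commutes-resp : ∀ {g g' h h'} → g ≈ g' → h ≈ h' → Commutes g h → Commutes g' h'
  commutes-resp g≈g' h≈h' gh≈hg =
    trans (∙-cong (sym g≈g') (sym h≈h')) (trans gh≈hg (∙-cong h≈h' g≈g'))

  commutes-∙ : ∀ {c g h} → Commutes c g → Commutes c h → Commutes c (g ∙ h)
  commutes-∙ {c} {g} {h} cg ch = begin
    c ∙ (g ∙ h)  ≈⟨ assoc c g h ⟨
    (c ∙ g) ∙ h  ≈⟨ ∙-congʳ cg ⟩
    (g ∙ c) ∙ h  ≈⟨ assoc g c h ⟩
    g ∙ (c ∙ h)  ≈⟨ ∙-congˡ ch ⟩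
    g ∙ (h ∙ c)  ≈⟨ assoc g h c ⟨
    (g ∙ h) ∙ c  ∎

  -- c g = g c  gives  c = g⁻¹ c g,  hence  c g⁻¹ = g⁻¹ c
  commutes-⁻¹ : ∀ {c g} → Commutes c g → Commutes c (g ⁻¹)
  commutes-⁻¹ {c} {g} cg = begin
    c ∙ g ⁻¹                ≈⟨ identityˡ _ ⟨
    ε ∙ (c ∙ g ⁻¹)          ≈⟨ ∙-congʳ (inverseˡ g) ⟨
    (g ⁻¹ ∙ g) ∙ (c ∙ g ⁻¹) ≈⟨ assoc _ _ _ ⟩
    g ⁻¹ ∙ (g ∙ (c ∙ g ⁻¹)) ≈⟨ ∙-congˡ (assoc g c (g ⁻¹)) ⟨
    g ⁻¹ ∙ ((g ∙ c) ∙ g ⁻¹) ≈⟨ ∙-congˡ (∙-congʳ cg) ⟨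
    g ⁻¹ ∙ ((c ∙ g) ∙ g ⁻¹) ≈⟨ ∙-congˡ (assoc c g (g ⁻¹)) ⟩
    g ⁻¹ ∙ (c ∙ (g ∙ g ⁻¹)) ≈⟨ ∙-congˡ (∙-congˡ (inverseʳ g)) ⟩
    g ⁻¹ ∙ (c ∙ ε)          ≈⟨ ∙-congˡ (identityʳ c) ⟩
    g ⁻¹ ∙ c                ∎

  commutes-word : ∀ {c x y} → Commutes c x → Commutes c y → ∀ w → Commutes c (evalWord G x y w)
  commutes-word cx cy wx      = cx
  commutes-word cx cy wy      = cy
  commutes-word cx cy we      = trans (identityʳ _) (sym (identityˡ _))
  commutes-word cx cy (w · v) = commutes-∙ (commutes-word cx cy w) (commutes-word cx cy v)
  commutes-word cx cy (w ⁻)   = commutes-⁻¹ (commutes-word cx cy w)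

  generated-abelian : ∀ {x y} → Generates G x y → Commutes x y → ∀ g h → Commutes g h
  generated-abelian {x} {y} gen xy g h with gen g | gen h
  ... | w , w≈g | v , v≈h =
    commutes-resp w≈g v≈h (commutes-word (sym (commutes-word refl xy w))
                                         (sym (commutes-word (sym xy) refl w)) v)

  commutator-trivial⇒commutes : ∀ g h → ((g ⁻¹ ∙ h ⁻¹) ∙ g) ∙ h ≈ ε → Commutes g h
  commutator-trivial⇒commutes g h [g,h]≈ε = begin
    g ∙ h                 ≈⟨ inverseʳ-unique _ _ (trans (sym (assoc _ _ _)) [g,h]≈ε) ⟩
    (g ⁻¹ ∙ h ⁻¹) ⁻¹      ≈⟨ ⁻¹-anti-homo-∙ _ _ ⟩
    (h ⁻¹) ⁻¹ ∙ (g ⁻¹) ⁻¹ ≈⟨ ∙-cong (⁻¹-involutive h) (⁻¹-involutive g) ⟩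
    h ∙ g                 ∎

  commutes⇒commutator-trivial : ∀ g h → Commutes g h → ((g ⁻¹ ∙ h ⁻¹) ∙ g) ∙ h ≈ ε
  commutes⇒commutator-trivial g h gh≈hg = begin
    ((g ⁻¹ ∙ h ⁻¹) ∙ g) ∙ h   ≈⟨ assoc _ _ _ ⟩
    (g ⁻¹ ∙ h ⁻¹) ∙ (g ∙ h)   ≈⟨ ∙-congˡ gh≈hg ⟩
    (g ⁻¹ ∙ h ⁻¹) ∙ (h ∙ g)   ≈⟨ assoc _ _ _ ⟩
    g ⁻¹ ∙ (h ⁻¹ ∙ (h ∙ g))   ≈⟨ ∙-congˡ (assoc _ _ _) ⟨
    g ⁻¹ ∙ ((h ⁻¹ ∙ h) ∙ g)   ≈⟨ ∙-congˡ (∙-congʳ (inverseˡ h)) ⟩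
    g ⁻¹ ∙ (ε ∙ g)            ≈⟨ ∙-congˡ (identityˡ g) ⟩
    g ⁻¹ ∙ g                  ≈⟨ inverseˡ g ⟩
    ε                         ∎

  module Abelian (comm : ∀ g h → Commutes g h) where
    open PowerLaws G
    open import Algebra.Properties.Group G using (ε⁻¹≈ε)

    interchange : ∀ a b c d → (a ∙ b) ∙ (c ∙ d) ≈ (a ∙ c) ∙ (b ∙ d)
    interchange a b c d = begin
      (a ∙ b) ∙ (c ∙ d)  ≈⟨ assoc _ _ _ ⟩
      a ∙ (b ∙ (c ∙ d))  ≈⟨ ∙-congˡ (assoc _ _ _) ⟨
      a ∙ ((b ∙ c) ∙ d)  ≈⟨ ∙-congˡ (∙-congʳ (comm b c)) ⟩
      a ∙ ((c ∙ b) ∙ d)  ≈⟨ ∙-congˡ (assoc _ _ _) ⟩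
      a ∙ (c ∙ (b ∙ d))  ≈⟨ assoc _ _ _ ⟨
      (a ∙ c) ∙ (b ∙ d)  ∎

    pow-∙ : ∀ g h n → (g ∙ h) ^ᴳ n ≈ g ^ᴳ n ∙ h ^ᴳ n
    pow-∙ g h zero    = sym (identityˡ ε)
    pow-∙ g h (suc n) = trans (∙-congˡ (pow-∙ g h n)) (interchange g h _ _)

    ⁻¹-homo-∙ : ∀ g h → (g ∙ h) ⁻¹ ≈ g ⁻¹ ∙ h ⁻¹
    ⁻¹-homo-∙ g h = trans (⁻¹-anti-homo-∙ g h) (comm (h ⁻¹) (g ⁻¹))

    generated-exponent : ∀ {x y N} → Generates G x y → x ^ᴳ N ≈ ε → y ^ᴳ N ≈ ε →
                         ∀ g → g ^ᴳ N ≈ ε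
    generated-exponent {x} {y} {N} gen xᴺ≈ε yᴺ≈ε g with gen g
    ... | w , w≈g = trans (pow-cong N (sym w≈g)) (word-exponent w)
      where
      word-exponent : ∀ w → evalWord G x y w ^ᴳ N ≈ ε
      word-exponent wx      = xᴺ≈ε
      word-exponent wy      = yᴺ≈ε
      word-exponent we      = pow-ε N
      word-exponent (w · v) =
        trans (pow-∙ _ _ N) (trans (∙-cong (word-exponent w) (word-exponent v)) (identityˡ ε))
      word-exponent (w ⁻)   =
        trans (pow-⁻¹ _ N) (trans (⁻¹-cong (word-exponent w)) ε⁻¹≈ε)

module Homomorphisms (G H : Group 0ℓ 0ℓ) where
  private
    module G = Group G
    module H = Group H
  open GroupMorphisms (Group.rawGroup G) (Group.rawGroup H) public

  mkGroupHomomorphism : (f : G.Carrier → H.Carrier) →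
    (∀ {g g'} → g G.≈ g' → f g H.≈ f g') →
    (∀ g g' → f (g G.∙ g') H.≈ f g H.∙ f g') →
    f G.ε H.≈ H.ε →
    (∀ g → f (g G.⁻¹) H.≈ f g H.⁻¹) →
    IsGroupHomomorphism f
  mkGroupHomomorphism f f-cong f-∙ f-ε f-⁻¹ = record
    { isMonoidHomomorphism = record
      { isMagmaHomomorphism = record
        { isRelHomomorphism = record { cong = f-cong }
        ; homo = f-∙ }
      ; ε-homo = f-ε }
    ; ⁻¹-homo = f-⁻¹ }

  inverse⇒isomorphism : ∀ {f : G.Carrier → H.Carrier} {f⁻ : H.Carrier → G.Carrier} →
    IsGroupHomomorphism f →
    (∀ {h h'} → h H.≈ h' → f⁻ h G.≈ f⁻ h') →
    (∀ h → f (f⁻ h) H.≈ h) → (∀ g → f⁻ (f g) G.≈ g) →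
    IsGroupIsomorphism f
  inverse⇒isomorphism {f} {f⁻} f-hom f⁻-cong ff⁻ f⁻f = record
    { isGroupMonomorphism = record
      { isGroupHomomorphism = f-hom
      ; injective = λ {g} {g'} fg≈fg' →
          G.trans (G.sym (f⁻f g)) (G.trans (f⁻-cong fg≈fg') (f⁻f g')) }
    ; surjective = λ h → f⁻ h , λ g≈f⁻h → H.trans (⟦⟧-cong g≈f⁻h) (ff⁻ h) }
    where open IsGroupHomomorphism f-hom using (⟦⟧-cong)

  hom-pow : ∀ {f} → IsGroupHomomorphism f → ∀ g n → f (pow G g n) H.≈ pow H (f g) n
  hom-pow f-hom g zero    = ε-homo
    where open IsGroupHomomorphism f-hom
  hom-pow f-hom g (suc n) = H.trans (homo g _) (H.∙-congˡ (hom-pow f-hom g n))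
    where open IsGroupHomomorphism f-hom

triple-trans : ∀ {G₁ G₂ G₃ : Group 0ℓ 0ℓ} {x₁ y₁ x₂ y₂ x₃ y₃} →
  TripleIso G₁ x₁ y₁ G₂ x₂ y₂ → TripleIso G₂ x₂ y₂ G₃ x₃ y₃ → TripleIso G₁ x₁ y₁ G₃ x₃ y₃
triple-trans {G₃ = G₃} (f , f-iso , fx , fy) (g , g-iso , gx , gy) =
  (λ z → g (f z)) , Composition.isGroupIsomorphism (Group.trans G₃) f-iso g-iso
  , Group.trans G₃ (⟦⟧-cong fx) gx , Group.trans G₃ (⟦⟧-cong fy) gy
  where
  import Algebra.Morphism.Construct.Composition as Composition
  open GroupMorphisms.IsGroupIsomorphism g-iso using (⟦⟧-cong)

-- This divisibility form of the order transports along maps and powers, and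
-- it determines the order in the sense of IsOrder.
module Periods (G : Group 0ℓ 0ℓ) where
  open Group G
  open PowerLaws G
  open import Algebra.Properties.Group G using (ε⁻¹≈ε; ⁻¹-involutive)
  open import Data.Integer using (-[1+_]; ∣_∣)
  open import Data.Nat using (>-nonZero; z<s)
  open import Data.Nat.Properties using (<⇒≱; ≮⇒≥; ≤-antisym; <-irrefl)
  open import Data.Empty using (⊥-elim)
  open import Data.Nat.Divisibility using (∣⇒≤; ∣-antisym; 0∣⇒≡0)
  import Data.Nat.Coprimality as Coprimality

  record HasPeriod (g : Carrier) (N : ℕ) : Set where
    field
      annihilates     : g ^ᴳ N ≈ ε
      divides-trivial : ∀ m → g ^ᴳ m ≈ ε → N ∣ m
  open HasPeriod public

  period⇒order : ∀ {g N} → 0 < N → HasPeriod g N → IsOrder G g N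
  period⇒order N>0 per = N>0 , annihilates per , λ m m>0 m<N gᵐ≈ε →
    <⇒≱ m<N (∣⇒≤ {{>-nonZero m>0}} (divides-trivial per m gᵐ≈ε))

  order≡period : ∀ {g N n} → HasPeriod g N → IsOrder G g n → n ≡ N
  order≡period {N = zero} per (n>0 , gⁿ≈ε , _) =
    ⊥-elim (<-irrefl (≡.sym (0∣⇒≡0 (divides-trivial per _ gⁿ≈ε))) n>0)
  order≡period {N = suc N} per (n>0 , gⁿ≈ε , minimal) =
    ≤-antisym (≮⇒≥ λ N<n → minimal (suc N) z<s N<n (annihilates per))
              (∣⇒≤ {{>-nonZero n>0}} (divides-trivial per _ gⁿ≈ε))

  period-unique : ∀ {g N N'} → HasPeriod g N → HasPeriod g N' → N ≡ N'
  period-unique per per' =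
    ∣-antisym (divides-trivial per _ (annihilates per')) (divides-trivial per' _ (annihilates per))

  period-resp : ∀ {g h N} → g ≈ h → HasPeriod g N → HasPeriod h N
  period-resp {N = N} g≈h per = record
    { annihilates     = trans (pow-cong N (sym g≈h)) (annihilates per)
    ; divides-trivial = λ m hᵐ≈ε → divides-trivial per m (trans (pow-cong m g≈h) hᵐ≈ε) }

  period-pow : ∀ {g N s} → HasPeriod g N → Coprime s N → HasPeriod (g ^ᴳ s) N
  period-pow {g} {N} {s} per s⊥N = record
    { annihilates     = trans (pow-pow-comm g s N) (trans (pow-cong s (annihilates per)) (pow-ε s))
    ; divides-trivial = λ m gˢᵐ≈ε →
        Coprimality.coprime-divisor (Coprimality.sym s⊥N)
          (≡.subst (N ∣_) (*-comm m s) (divides-trivial per (m * s) (trans (pow-* g m s) gˢᵐ≈ε))) }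

  period-⁻¹ : ∀ {g N} → HasPeriod g N → HasPeriod (g ⁻¹) N
  period-⁻¹ {g} {N} per = record
    { annihilates     = trans (pow-⁻¹ g N) (trans (⁻¹-cong (annihilates per)) ε⁻¹≈ε)
    ; divides-trivial = λ m g⁻ᵐ≈ε → divides-trivial per m
        (trans (sym (⁻¹-involutive _))
          (trans (⁻¹-cong (trans (sym (pow-⁻¹ g m)) g⁻ᵐ≈ε)) ε⁻¹≈ε)) }

  period-powℤ : ∀ {g N} j → HasPeriod g N → Coprime ∣ j ∣ N → HasPeriod (powℤ G g j) N
  period-powℤ (+ s)      per s⊥N = period-pow per s⊥N
  period-powℤ -[1+ n ]   per s⊥N = period-⁻¹ (period-pow per s⊥N)

  admissible⇒coprime : ∀ {g N j} → HasPeriod g N → CoprimeToOrder G g j → Coprime ∣ j ∣ N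
  admissible⇒coprime per (n , order , j⊥n) = ≡.subst (Coprime _) (order≡period per order) j⊥n

period-monomorphism : ∀ (G H : Group 0ℓ 0ℓ) {f g N} →
  GroupMorphisms.IsGroupMonomorphism (Group.rawGroup G) (Group.rawGroup H) f →
  Periods.HasPeriod G g N → Periods.HasPeriod H (f g) N
period-monomorphism G H {f} {g} {N} f-mono per = record
  { annihilates     = H.trans (H.sym (hom-pow isGroupHomomorphism g N))
                              (H.trans (⟦⟧-cong (annihilates per)) ε-homo)
  ; divides-trivial = λ m fgᵐ≈ε → divides-trivial per m (injective
      (H.trans (hom-pow isGroupHomomorphism g m) (H.trans fgᵐ≈ε (H.sym ε-homo)))) }
  where
  module H = Group H
  open Periods G using (annihilates; divides-trivial)
  open Homomorphisms G H using (hom-pow)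
  open GroupMorphisms.IsGroupMonomorphism f-mono

Satisfies : List (Word × Word) → (H : Group 0ℓ 0ℓ) → Group.Carrier H → Group.Carrier H → Set
Satisfies R H X Y = ∀ {l r} → (l , r) ∈ R → Group._≈_ H (evalWord H X Y l) (evalWord H X Y r)

evalWord-wpow : ∀ (H : Group 0ℓ 0ℓ) X Y w n → evalWord H X Y (wpow w n) ≡ pow H (evalWord H X Y w) n
evalWord-wpow H X Y w zero    = ≡.refl
evalWord-wpow H X Y w (suc n) = ≡.cong (Group._∙_ H (evalWord H X Y w)) (evalWord-wpow H X Y w n)

module Presented (R : List (Word × Word)) where
  open Presentation R

  pow≡wpow : ∀ w n → pow group w n ≡ wpow w n
  pow≡wpow w zero    = ≡.refl
  pow≡wpow w (suc n) = ≡.cong (w ·_) (pow≡wpow w n)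

  evalWord-pow : ∀ (H : Group 0ℓ 0ℓ) X Y w n →
    evalWord H X Y (pow group w n) ≡ pow H (evalWord H X Y w) n
  evalWord-pow H X Y w n =
    ≡.trans (≡.cong (evalWord H X Y) (pow≡wpow w n)) (evalWord-wpow H X Y w n)

  module Substitution (H : Group 0ℓ 0ℓ) {X Y : Group.Carrier H} (sat : Satisfies R H X Y) where
    private
      module H = Group H

    evalWord-resp : ∀ {w v} → w ≈ᴾ v → evalWord H X Y w H.≈ evalWord H X Y v
    evalWord-resp ≈-refl          = H.refl
    evalWord-resp (≈-sym e)       = H.sym (evalWord-resp e)
    evalWord-resp (≈-trans e f)   = H.trans (evalWord-resp e) (evalWord-resp f)
    evalWord-resp (·-cong e f)    = H.∙-cong (evalWord-resp e) (evalWord-resp f)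
    evalWord-resp (⁻-cong e)      = H.⁻¹-cong (evalWord-resp e)
    evalWord-resp (assoc u v w)   = H.assoc _ _ _
    evalWord-resp (idˡ w)         = H.identityˡ _
    evalWord-resp (idʳ w)         = H.identityʳ _
    evalWord-resp (invˡ w)        = H.inverseˡ _
    evalWord-resp (invʳ w)        = H.inverseʳ _
    evalWord-resp (rel l≡r∈R)     = sat l≡r∈R

    substitution-hom : Homomorphisms.IsGroupHomomorphism group H (evalWord H X Y)
    substitution-hom = Homomorphisms.mkGroupHomomorphism group H (evalWord H X Y)
      evalWord-resp (λ _ _ → H.refl) H.refl (λ _ → H.refl)

substitution-inverse : ∀ R₁ R₂ {X Y X' Y'} →
  let G₂ = Presentation.group R₂ in
  Group._≈_ G₂ (evalWord G₂ X Y X') wx → Group._≈_ G₂ (evalWord G₂ X Y Y') wy →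
  ∀ w → Group._≈_ G₂ (evalWord G₂ X Y (evalWord (Presentation.group R₁) X' Y' w)) w
substitution-inverse R₁ R₂ x↦x y↦y wx      = x↦x
substitution-inverse R₁ R₂ x↦x y↦y wy      = y↦y
substitution-inverse R₁ R₂ x↦x y↦y we      = Group.refl (Presentation.group R₂)
substitution-inverse R₁ R₂ x↦x y↦y (w · v) = Group.∙-cong (Presentation.group R₂)
  (substitution-inverse R₁ R₂ x↦x y↦y w) (substitution-inverse R₁ R₂ x↦x y↦y v)
substitution-inverse R₁ R₂ x↦x y↦y (w ⁻)   = Group.⁻¹-cong (Presentation.group R₂)
  (substitution-inverse R₁ R₂ x↦x y↦y w)

presentation-iso : ∀ R₁ R₂ {X Y X' Y'} →
  let G₁ = Presentation.group R₁
      G₂ = Presentation.group R₂ in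
  Satisfies R₁ G₂ X Y → Satisfies R₂ G₁ X' Y' →
  Group._≈_ G₂ (evalWord G₂ X Y X') wx → Group._≈_ G₂ (evalWord G₂ X Y Y') wy →
  Group._≈_ G₁ (evalWord G₁ X' Y' X) wx → Group._≈_ G₁ (evalWord G₁ X' Y' Y) wy →
  Homomorphisms.IsGroupIsomorphism G₁ G₂ (evalWord G₂ X Y)
presentation-iso R₁ R₂ sat sat' x↦x y↦y x↦x' y↦y' =
  Homomorphisms.inverse⇒isomorphism (Presentation.group R₁) (Presentation.group R₂)
    (Presented.Substitution.substitution-hom R₁ (Presentation.group R₂) sat)
    (Presented.Substitution.evalWord-resp R₂ (Presentation.group R₁) sat')
    (substitution-inverse R₁ R₂ x↦x y↦y)
    (substitution-inverse R₂ R₁ x↦x' y↦y')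

-- The cyclic group ℤ/M, realised as ℤ with equality modulo M.  Homomorphisms
-- from a presented group into it give the lower bounds on element orders.
module CyclicModel (M : ℕ) where
  open import Data.Integer as ℤ using (ℤ; -_; ∣_∣)
  open import Data.Integer.Properties as ℤₚ using (pos-*; pos-+; abs-*)
  open import Data.Integer.Tactic.RingSolver using (solve-∀)
  open ≡.≡-Reasoning

  infix 4 _≡ₘ_
  record _≡ₘ_ (u v : ℤ) : Set where
    constructor _,_
    field
      quotient   : ℤ
      difference : u ≡ v ℤ.+ quotient ℤ.* + M

  ≡⇒≡ₘ : ∀ {u v} → u ≡ v → u ≡ₘ v
  ≡⇒≡ₘ {u} ≡.refl = + 0 , lemma u (+ M)
    where
    lemma : ∀ u m → u ≡ u ℤ.+ + 0 ℤ.* m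
    lemma = solve-∀

  ≡ₘ-sym : ∀ {u v} → u ≡ₘ v → v ≡ₘ u
  ≡ₘ-sym {v = v} (q , ≡.refl) = - q , lemma v q (+ M)
    where
    lemma : ∀ v q m → v ≡ (v ℤ.+ q ℤ.* m) ℤ.+ (- q) ℤ.* m
    lemma = solve-∀

  ≡ₘ-trans : ∀ {u v w} → u ≡ₘ v → v ≡ₘ w → u ≡ₘ w
  ≡ₘ-trans {w = w} (q , ≡.refl) (r , ≡.refl) = r ℤ.+ q , lemma w q r (+ M)
    where
    lemma : ∀ w q r m → (w ℤ.+ r ℤ.* m) ℤ.+ q ℤ.* m ≡ w ℤ.+ (r ℤ.+ q) ℤ.* m
    lemma = solve-∀

  ≡ₘ-+ : ∀ {u u' v v'} → u ≡ₘ u' → v ≡ₘ v' → u ℤ.+ v ≡ₘ u' ℤ.+ v'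
  ≡ₘ-+ {u' = u'} {v' = v'} (q , ≡.refl) (r , ≡.refl) = q ℤ.+ r , lemma u' v' q r (+ M)
    where
    lemma : ∀ u v q r m → (u ℤ.+ q ℤ.* m) ℤ.+ (v ℤ.+ r ℤ.* m) ≡ (u ℤ.+ v) ℤ.+ (q ℤ.+ r) ℤ.* m
    lemma = solve-∀

  ≡ₘ-neg : ∀ {u u'} → u ≡ₘ u' → - u ≡ₘ - u'
  ≡ₘ-neg {u' = u'} (q , ≡.refl) = - q , lemma u' q (+ M)
    where
    lemma : ∀ u q m → - (u ℤ.+ q ℤ.* m) ≡ - u ℤ.+ (- q) ℤ.* m
    lemma = solve-∀

  cyclic : Group 0ℓ 0ℓ
  cyclic = record
    { Carrier = ℤ
    ; _≈_     = _≡ₘ_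
    ; _∙_     = ℤ._+_
    ; ε       = + 0
    ; _⁻¹     = -_
    ; isGroup = record
      { isMonoid = record
        { isSemigroup = record
          { isMagma = record
            { isEquivalence = record { refl = ≡⇒≡ₘ ≡.refl ; sym = ≡ₘ-sym ; trans = ≡ₘ-trans }
            ; ∙-cong = ≡ₘ-+ }
          ; assoc = λ u v w → ≡⇒≡ₘ (ℤₚ.+-assoc u v w) }
        ; identity = (λ u → ≡⇒≡ₘ (ℤₚ.+-identityˡ u))
                   , (λ u → ≡⇒≡ₘ (ℤₚ.+-identityʳ u)) }
      ; inverse = (λ u → ≡⇒≡ₘ (ℤₚ.+-inverseˡ u))
                , (λ u → ≡⇒≡ₘ (ℤₚ.+-inverseʳ u))
      ; ⁻¹-cong = ≡ₘ-neg }
    }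

  pow-cyclic : ∀ u n → pow cyclic u n ≡ + n ℤ.* u
  pow-cyclic u zero    = ≡.refl
  pow-cyclic u (suc n) = ≡.trans (≡.cong (λ v → u ℤ.+ v) (pow-cyclic u n)) (lemma u (+ n))
    where
    lemma : ∀ u n → u ℤ.+ n ℤ.* u ≡ (+ 1 ℤ.+ n) ℤ.* u
    lemma = solve-∀

  vanishes⇒divisible : ∀ {n} → + n ≡ₘ + 0 → M ∣ n
  vanishes⇒divisible {n} (q , n≡qM) = divides ∣ q ∣ (begin
    n                     ≡⟨ ≡.cong ∣_∣ n≡qM ⟩
    ∣ + 0 ℤ.+ q ℤ.* + M ∣ ≡⟨ ≡.cong ∣_∣ (ℤₚ.+-identityˡ (q ℤ.* + M)) ⟩
    ∣ q ℤ.* + M ∣         ≡⟨ abs-* q (+ M) ⟩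
    ∣ q ∣ * M             ∎)

  congruent⇒≡ₘ : ∀ {u v} t → u ≡ v + t * M → + u ≡ₘ + v
  congruent⇒≡ₘ {u} {v} t u≡v+tM = + t , (begin
    + u                  ≡⟨ ≡.cong +_ u≡v+tM ⟩
    + (v + t * M)        ≡⟨ pos-+ v (t * M) ⟩
    + v ℤ.+ + (t * M)    ≡⟨ ≡.cong (λ w → + v ℤ.+ w) (pos-* t M) ⟩
    + v ℤ.+ + t ℤ.* + M  ∎)

  divisible⇒vanishes : ∀ {n} → M ∣ n → + n ≡ₘ + 0
  divisible⇒vanishes (divides t n≡tM) = congruent⇒≡ₘ t n≡tM

  pow-cyclic-ℕ : ∀ X n → pow cyclic (+ X) n ≡ + (n * X)
  pow-cyclic-ℕ X n = ≡.trans (pow-cyclic (+ X) n) (≡.sym (pos-* n X))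

  model-divides : ∀ R {X Y} → Satisfies R cyclic (+ X) (+ Y) →
    ∀ w {V} → evalWord cyclic (+ X) (+ Y) w ≡ + V →
    ∀ m → Group._≈_ (Presentation.group R) (pow (Presentation.group R) w m) we → M ∣ m * V
  model-divides R {X} {Y} sat w {V} w↦V m wᵐ≈ε = vanishes⇒divisible (≡ₘ-trans
    (≡⇒≡ₘ (≡.sym image-of-wᵐ)) (Presented.Substitution.evalWord-resp R cyclic sat wᵐ≈ε))
    where
    image-of-wᵐ : evalWord cyclic (+ X) (+ Y) (pow (Presentation.group R) w m) ≡ + (m * V)
    image-of-wᵐ = begin
      evalWord cyclic (+ X) (+ Y) (pow (Presentation.group R) w m)
        ≡⟨ ≡.cong (evalWord cyclic (+ X) (+ Y)) (Presented.pow≡wpow R w m) ⟩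
      evalWord cyclic (+ X) (+ Y) (wpow w m)  ≡⟨ evalWord-wpow cyclic (+ X) (+ Y) w m ⟩
      pow cyclic (evalWord cyclic (+ X) (+ Y) w) m  ≡⟨ ≡.cong (λ u → pow cyclic u m) w↦V ⟩
      pow cyclic (+ V) m                      ≡⟨ pow-cyclic-ℕ V m ⟩
      + (m * V)                               ∎

module Arithmetic where
  open import Data.Nat.Base using (nonTrivial⇒n>1)
  open import Data.Nat.Properties
    using (*-assoc; *-identityˡ; <-cmp; <-irrefl; ^-monoʳ-<; m∸n+n≡m; ^-distribˡ-+-*)
  open import Data.Nat.Divisibility using (∣-trans; ∣1⇒≡1; m∣m*n; ∣n⇒∣m*n; n∣m⇒m%n≡0)
  open import Data.Nat.DivMod using (%-distribˡ-*; [m+kn]%n≡m%n; m∣n⇒o%n%m≡o%m; n%1≡0; m<n⇒m%n≡m)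
  open import Data.Nat.Coprimality using (coprime-divisor; coprime-Bézout)
  open import Data.Nat.GCD using (module Bézout)
  open import Data.Nat.Primality using (prime⇒nonZero; prime⇒nonTrivial; prime⇒irreducible; euclidsLemma)
  open import Data.Nat.Tactic.RingSolver using (solve-∀)
  open import Data.Empty using (⊥-elim)
  open import Data.Sum using (inj₁; inj₂)
  open import Relation.Nullary using (¬_)
  open import Relation.Binary.Definitions using (tri<; tri≈; tri>)
  open ≡.≡-Reasoning

  prime>1 : ∀ {p} → Prime p → 1 < p
  prime>1 {p} p-prime = nonTrivial⇒n>1 p {{prime⇒nonTrivial p-prime}}

  ^-injective : ∀ {p m n} → 1 < p → p ^ m ≡ p ^ n → m ≡ n
  ^-injective {p} {m} {n} p>1 pᵐ≡pⁿ with <-cmp m n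
  ... | tri< m<n _ _ = ⊥-elim (<-irrefl pᵐ≡pⁿ (^-monoʳ-< p p>1 m<n))
  ... | tri≈ _ m≡n _ = m≡n
  ... | tri> _ _ n<m = ⊥-elim (<-irrefl (≡.sym pᵐ≡pⁿ) (^-monoʳ-< p p>1 n<m))

  pow-∣ : ∀ p {m n} → m ≤ n → p ^ m ∣ p ^ n
  pow-∣ p {m} {n} m≤n =
    divides (p ^ (n ∸ m))
      (≡.trans (≡.cong (p ^_) (≡.sym (m∸n+n≡m m≤n))) (^-distribˡ-+-* p (n ∸ m) m))

  coprime-pow : ∀ {s n} → Coprime s n → ∀ k → Coprime s (n ^ k)
  coprime-pow s⊥n zero    (_ , d∣1)              = ∣1⇒≡1 d∣1
  coprime-pow {s} {n} s⊥n (suc k) {d} (d∣s , d∣nⁿᵏ) =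
    coprime-pow s⊥n k (d∣s , coprime-divisor d⊥n d∣nⁿᵏ)
    where
    d⊥n : Coprime d n
    d⊥n (i∣d , i∣n) = s⊥n (∣-trans i∣d d∣s , i∣n)

  prime∤⇒coprime : ∀ {p s} → Prime p → ¬ p ∣ s → Coprime s p
  prime∤⇒coprime p-prime p∤s (d∣s , d∣p) with prime⇒irreducible p-prime d∣p
  ... | inj₁ d≡1    = d≡1
  ... | inj₂ ≡.refl = ⊥-elim (p∤s d∣s)

  prime∤⇒coprime-pow : ∀ {p s} → Prime p → ¬ p ∣ s → ∀ k → Coprime s (p ^ k)
  prime∤⇒coprime-pow p-prime p∤s = coprime-pow (prime∤⇒coprime p-prime p∤s)

  coprime-pow⇒∤ : ∀ {p s k} → Prime p → Coprime s (p ^ suc k) → ¬ p ∣ s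
  coprime-pow⇒∤ {p} {k = k} p-prime s⊥pᵏ⁺¹ p∣s =
    <-irrefl (≡.sym (s⊥pᵏ⁺¹ (p∣s , m∣m*n (p ^ k)))) (prime>1 p-prime)

  %-cong-* : ∀ {u v} w N .{{_ : NonZero N}} → u % N ≡ v % N → (u * w) % N ≡ (v * w) % N
  %-cong-* {u} {v} w N u≡v = begin
    (u * w) % N              ≡⟨ %-distribˡ-* u w N ⟩
    ((u % N) * (w % N)) % N  ≡⟨ ≡.cong (λ z → (z * (w % N)) % N) u≡v ⟩
    ((v % N) * (w % N)) % N  ≡⟨ %-distribˡ-* v w N ⟨
    (v * w) % N              ∎

  %-divisor : ∀ {u v} M N .{{_ : NonZero M}} .{{_ : NonZero N}} → M ∣ N →
              u % N ≡ v % N → u % M ≡ v % M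
  %-divisor {u} {v} M N M∣N u≡v = begin
    u % M      ≡⟨ m∣n⇒o%n%m≡o%m M N u M∣N ⟨
    u % N % M  ≡⟨ ≡.cong (_% M) u≡v ⟩
    v % N % M  ≡⟨ m∣n⇒o%n%m≡o%m M N v M∣N ⟩
    v % M      ∎

  modular-inverse : ∀ {s} N .{{_ : NonZero N}} → Coprime s N → ∃ λ k → (s * k) % N ≡ 1 % N
  modular-inverse {s} N s⊥N with coprime-Bézout s⊥N
  ... | Bézout.+- x y 1+yN≡xs = x , (begin
    (s * x) % N      ≡⟨ ≡.cong (_% N) (*-comm s x) ⟩
    (x * s) % N      ≡⟨ ≡.cong (_% N) 1+yN≡xs ⟨
    (1 + y * N) % N  ≡⟨ [m+kn]%n≡m%n 1 y N ⟩
    1 % N            ∎)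
  modular-inverse {s} N@(suc n) s⊥N | Bézout.-+ x y 1+xs≡yN = x * n , (begin
    (s * (x * n)) % N                ≡⟨ [m+kn]%n≡m%n (s * (x * n)) y N ⟨
    (s * (x * n) + y * N) % N        ≡⟨ ≡.cong (λ z → (s * (x * n) + z) % N) 1+xs≡yN ⟨
    (s * (x * n) + (1 + x * s)) % N  ≡⟨ ≡.cong (_% N) (lemma s x n) ⟩
    (1 + (x * s) * N) % N            ≡⟨ [m+kn]%n≡m%n 1 (x * s) N ⟩
    1 % N                            ∎)
    where
    lemma : ∀ s x n → s * (x * n) + (1 + x * s) ≡ 1 + (x * s) * (1 + n)
    lemma = solve-∀

  cancel-multiplier : ∀ {e₁ e₂ j k} N .{{_ : NonZero N}} →
    (e₁ * j) % N ≡ e₂ % N → (j * k) % N ≡ 1 % N → (e₂ * k) % N ≡ e₁ % N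
  cancel-multiplier {e₁} {e₂} {j} {k} N e₁j≡e₂ jk≡1 = begin
    (e₂ * k) % N      ≡⟨ %-cong-* k N e₁j≡e₂ ⟨
    (e₁ * j * k) % N  ≡⟨ ≡.cong (_% N) (≡.trans (*-assoc e₁ j k) (*-comm e₁ (j * k))) ⟩
    (j * k * e₁) % N  ≡⟨ %-cong-* e₁ N jk≡1 ⟩
    (1 * e₁) % N      ≡⟨ ≡.cong (_% N) (*-identityˡ e₁) ⟩
    e₁ % N            ∎

  unit-ratio : ∀ {p e₁ e₂} c .{{_ : NonZero (p ^ c)}} → Prime p →
    Coprime e₁ (p ^ c) → Coprime e₂ (p ^ c) →
    ∃ λ j → (e₁ * j) % p ^ c ≡ e₂ % p ^ c × ¬ p ∣ j
  unit-ratio {p} {e₁} {e₂} zero p-prime _ _ =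
    1 , ≡.trans (n%1≡0 (e₁ * 1)) (≡.sym (n%1≡0 e₂)) ,
    λ p∣1 → <-irrefl (≡.sym (∣1⇒≡1 p∣1)) (prime>1 p-prime)
  unit-ratio {p} {e₁} {e₂} c@(suc c') p-prime e₁⊥pᶜ e₂⊥pᶜ =
    e₂ * k , e₁e₂k≡e₂ , p∤e₂k
    where
    k : ℕ
    k = proj₁ (modular-inverse (p ^ c) e₁⊥pᶜ)
    e₁k≡1 : (e₁ * k) % p ^ c ≡ 1 % p ^ c
    e₁k≡1 = proj₂ (modular-inverse (p ^ c) e₁⊥pᶜ)

    e₁e₂k≡e₂ : (e₁ * (e₂ * k)) % p ^ c ≡ e₂ % p ^ c
    e₁e₂k≡e₂ = begin
      (e₁ * (e₂ * k)) % p ^ c  ≡⟨ ≡.cong (_% p ^ c) (lemma e₁ e₂ k) ⟩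
      (e₁ * k * e₂) % p ^ c    ≡⟨ %-cong-* e₂ (p ^ c) e₁k≡1 ⟩
      (1 * e₂) % p ^ c         ≡⟨ ≡.cong (_% p ^ c) (*-identityˡ e₂) ⟩
      e₂ % p ^ c               ∎
      where
      lemma : ∀ x y z → x * (y * z) ≡ x * z * y
      lemma = solve-∀

    -- k is a unit modulo p, since e₁ k ≡ 1 modulo p
    p∤k : ¬ p ∣ k
    p∤k p∣k = 0≢1+n (begin
      0                ≡⟨ n∣m⇒m%n≡0 (e₁ * k) p (∣n⇒∣m*n e₁ p∣k) ⟨
      (e₁ * k) % p     ≡⟨ %-divisor p (p ^ c) (m∣m*n (p ^ c')) e₁k≡1 ⟩
      1 % p            ≡⟨ m<n⇒m%n≡m (prime>1 p-prime) ⟩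
      1                ∎)
      where
      instance
        p≢0 : NonZero p
        p≢0 = prime⇒nonZero p-prime
      open import Data.Nat.Properties using (0≢1+n)

    p∤e₂k : ¬ p ∣ e₂ * k
    p∤e₂k p∣e₂k with euclidsLemma e₂ k p-prime p∣e₂k
    ... | inj₁ p∣e₂ = coprime-pow⇒∤ {k = c'} p-prime e₂⊥pᶜ p∣e₂
    ... | inj₂ p∣k  = p∤k p∣k

satisfies-A : ∀ p a b c e (H : Group 0ℓ 0ℓ) {X Y : Group.Carrier H} →
  let open Group H in
  pow H X (p ^ b) ≈ ε → pow H Y (p ^ (a + c)) ≈ ε → Commutation.Commutes H X Y →
  pow H Y (p ^ a) ≈ pow H X (e * p ^ (b ∸ c)) → Satisfies (A-relations p a b c e) H X Y
satisfies-A p a b c e H {X} {Y} x-rel y-rel xy≈yx mixed = relation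
  where
  open Group H
  relation : Satisfies (A-relations p a b c e) H X Y
  relation (here ≡.refl)                         =
    trans (reflexive (evalWord-wpow H X Y wx (p ^ b))) x-rel
  relation (there (here ≡.refl))                 =
    trans (reflexive (evalWord-wpow H X Y wy (p ^ (a + c)))) y-rel
  relation (there (there (here ≡.refl)))         =
    Commutation.commutes⇒commutator-trivial H X Y xy≈yx
  relation (there (there (there (here ≡.refl)))) =
    trans (reflexive (evalWord-wpow H X Y wy (p ^ a)))
      (trans mixed (sym (reflexive (evalWord-wpow H X Y wx (e * p ^ (b ∸ c))))))

cyclic-satisfies-A : ∀ p a b c e M {X Y} →
  M ∣ p ^ b * X → M ∣ p ^ (a + c) * Y → (∃ λ t → p ^ a * Y ≡ e * p ^ (b ∸ c) * X + t * M) →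
  Satisfies (A-relations p a b c e) (CyclicModel.cyclic M) (+ X) (+ Y)
cyclic-satisfies-A p a b c e M {X} {Y} M∣pᵇX M∣pᵃ⁺ᶜY (t , mixed) =
  satisfies-A p a b c e cyclic
    (trans (≡⇒≡ₘ (pow-cyclic-ℕ X (p ^ b))) (divisible⇒vanishes M∣pᵇX))
    (trans (≡⇒≡ₘ (pow-cyclic-ℕ Y (p ^ (a + c)))) (divisible⇒vanishes M∣pᵃ⁺ᶜY))
    (≡⇒≡ₘ (ℤₚ.+-comm (+ X) (+ Y)))
    (trans (≡⇒≡ₘ (pow-cyclic-ℕ Y (p ^ a)))
      (trans (congruent⇒≡ₘ t mixed) (≡⇒≡ₘ (≡.sym (pow-cyclic-ℕ X (e * p ^ (b ∸ c)))))))
  where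
  open CyclicModel M
  open Group cyclic using (trans)
  import Data.Integer.Properties as ℤₚ

module AGroup (p a b c e : ℕ) where
  R : List (Word × Word)
  R = A-relations p a b c e

  G : Group 0ℓ 0ℓ
  G = Presentation.group R
  open Group G
  open PowerLaws G
  open Commutation G
  open Presentation R using (rel)

  x-relation : wx ^ᴳ p ^ b ≈ ε
  x-relation = trans (reflexive (Presented.pow≡wpow R wx (p ^ b))) (rel (here ≡.refl))

  y-relation : wy ^ᴳ p ^ (a + c) ≈ ε
  y-relation = trans (reflexive (Presented.pow≡wpow R wy (p ^ (a + c)))) (rel (there (here ≡.refl)))

  mixed-relation : wy ^ᴳ p ^ a ≈ wx ^ᴳ (e * p ^ (b ∸ c))
  mixed-relation = trans (reflexive (Presented.pow≡wpow R wy (p ^ a)))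
    (trans (rel (there (there (there (here ≡.refl)))))
      (sym (reflexive (Presented.pow≡wpow R wx (e * p ^ (b ∸ c))))))

  abelian : ∀ g h → Commutes g h
  abelian = generated-abelian (Presentation.generates R)
    (commutator-trivial⇒commutes wx wy (rel (there (there (here ≡.refl)))))

  open Abelian abelian

  exponent : a + c ≤ b → ∀ g → g ^ᴳ p ^ b ≈ ε
  exponent a+c≤b = generated-exponent {N = p ^ b} (Presentation.generates R) x-relation
    (pow-multiple wy y-relation (Arithmetic.pow-∣ p a+c≤b))

  sheared-satisfies : c ≤ b → .{{_ : NonZero (p ^ c)}} → ∀ m e' →
    (e * m) % p ^ c ≡ e' % p ^ c → Satisfies (A-relations p a b c e') G wx (wy ^ᴳ m)
  sheared-satisfies c≤b m e' em≡e' = satisfies-A p a b c e' G x-relation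
    (trans (pow-pow-comm wy m (p ^ (a + c))) (trans (pow-cong m y-relation) (pow-ε m)))
    (abelian wx (wy ^ᴳ m))
    mixed
    where
    open import Relation.Binary.Reasoning.Setoid setoid
    open import Data.Nat.Properties using (*-assoc; ^-distribˡ-+-*; m+[n∸m]≡n)
    P : ℕ
    P = p ^ (b ∸ c)

    xᴾ-relation : (wx ^ᴳ P) ^ᴳ p ^ c ≈ ε
    xᴾ-relation = trans (sym (pow-* wx (p ^ c) P))
      (trans (pow-≡ wx (≡.trans (≡.sym (^-distribˡ-+-* p c (b ∸ c)))
                                (≡.cong (p ^_) (m+[n∸m]≡n c≤b))))
        x-relation)

    mixed : (wy ^ᴳ m) ^ᴳ p ^ a ≈ wx ^ᴳ (e' * P)
    mixed = begin
      (wy ^ᴳ m) ^ᴳ p ^ a      ≈⟨ pow-pow-comm wy m (p ^ a) ⟩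
      (wy ^ᴳ p ^ a) ^ᴳ m      ≈⟨ pow-cong m mixed-relation ⟩
      (wx ^ᴳ (e * P)) ^ᴳ m    ≈⟨ pow-* wx m (e * P) ⟨
      wx ^ᴳ (m * (e * P))     ≈⟨ pow-≡ wx (≡.trans (≡.sym (*-assoc m e P)) (≡.cong (_* P) (*-comm m e))) ⟩
      wx ^ᴳ ((e * m) * P)     ≈⟨ pow-* wx (e * m) P ⟩
      (wx ^ᴳ P) ^ᴳ (e * m)    ≈⟨ pow-congruent (wx ^ᴳ P) (p ^ c) xᴾ-relation em≡e' ⟩
      (wx ^ᴳ P) ^ᴳ e'         ≈⟨ pow-* wx e' P ⟨
      wx ^ᴳ (e' * P)          ∎

-- The upper
-- bounds are relations; the lower bounds come from two points in cyclic
-- groups:  x ↦ 1, y ↦ e p^{b-a-c} in ℤ/pᵇ  and  x ↦ 0, y ↦ 1 in ℤ/pᵃ.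
module AOrders (p a b c e : ℕ) (p-prime : Prime p) (a+c≤b : a + c ≤ b)
               (e⊥pᶜ : Coprime e (p ^ c)) where
  open AGroup p a b c e
  open Group G using (_≈_; ε)
  open PowerLaws G using (_^ᴳ_)
  open Periods G
  open import Data.Nat using (_≟_; pred; ≢-nonZero)
  open import Data.Nat.Properties using (+-identityʳ; *-identityʳ; *-assoc; m≤m+n; m+[n∸m]≡n;
    m+n∸m≡n; ^-distribˡ-+-*; m^n≢0; suc-pred)
  open import Data.Nat.Divisibility using (m∣m*n; ∣m⇒∣m*n; ∣n⇒∣m*n; _∣0; *-cancelʳ-∣)
  open import Data.Nat.Coprimality using (coprime-divisor)
  import Data.Nat.Coprimality as Coprimality
  open import Data.Nat.Primality using (prime⇒nonZero)
  open import Data.Nat.Tactic.RingSolver using (solve-∀)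
  open import Relation.Nullary using (yes; no)
  open CyclicModel using (cyclic; model-divides)
  open ≡.≡-Reasoning

  instance
    p≢0 : NonZero p
    p≢0 = prime⇒nonZero p-prime

  Q : ℕ
  Q = b ∸ (a + c)

  pᵇ-split : p ^ b ≡ p ^ (a + c) * p ^ Q
  pᵇ-split = ≡.trans (≡.cong (p ^_) (≡.sym (m+[n∸m]≡n a+c≤b))) (^-distribˡ-+-* p (a + c) Q)

  pᵇ⁻ᶜ-split : p ^ (b ∸ c) ≡ p ^ a * p ^ Q
  pᵇ⁻ᶜ-split = begin
    p ^ (b ∸ c)                ≡⟨ ≡.cong (λ n → p ^ (n ∸ c)) (m+[n∸m]≡n a+c≤b) ⟨
    p ^ ((a + c) + Q ∸ c)      ≡⟨ ≡.cong (λ n → p ^ (n ∸ c)) (reorder a c Q) ⟩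
    p ^ (c + (a + Q) ∸ c)      ≡⟨ ≡.cong (p ^_) (m+n∸m≡n c (a + Q)) ⟩
    p ^ (a + Q)                ≡⟨ ^-distribˡ-+-* p a Q ⟩
    p ^ a * p ^ Q              ∎
    where
    reorder : ∀ a c q → (a + c) + q ≡ c + (a + q)
    reorder = solve-∀

  model-pᵇ : Satisfies R (cyclic (p ^ b)) (+ 1) (+ (e * p ^ Q))
  model-pᵇ = cyclic-satisfies-A p a b c e (p ^ b) (m∣m*n 1)
    (divides e (begin
      p ^ (a + c) * (e * p ^ Q)  ≡⟨ swap (p ^ (a + c)) e (p ^ Q) ⟩
      e * (p ^ (a + c) * p ^ Q)  ≡⟨ ≡.cong (e *_) pᵇ-split ⟨
      e * p ^ b                  ∎))
    (0 , (begin
      p ^ a * (e * p ^ Q)              ≡⟨ swap (p ^ a) e (p ^ Q) ⟩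
      e * (p ^ a * p ^ Q)              ≡⟨ ≡.cong (e *_) pᵇ⁻ᶜ-split ⟨
      e * p ^ (b ∸ c)                  ≡⟨ pad (e * p ^ (b ∸ c)) (p ^ b) ⟩
      e * p ^ (b ∸ c) * 1 + 0 * p ^ b  ∎))
    where
    swap : ∀ x y z → x * (y * z) ≡ y * (x * z)
    swap = solve-∀
    pad : ∀ x m → x ≡ x * 1 + 0 * m
    pad = solve-∀

  model-pᵃ : Satisfies R (cyclic (p ^ a)) (+ 0) (+ 1)
  model-pᵃ = cyclic-satisfies-A p a b c e (p ^ a) (∣n⇒∣m*n (p ^ b) ((p ^ a) ∣0))
    (∣m⇒∣m*n 1 (Arithmetic.pow-∣ p (m≤m+n a c)))
    (1 , identity (p ^ a) (e * p ^ (b ∸ c)))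
    where
    identity : ∀ x y → x * 1 ≡ y * 0 + 1 * x
    identity = solve-∀

  x-period : HasPeriod wx (p ^ b)
  x-period = record
    { annihilates     = x-relation
    ; divides-trivial = λ m xᵐ≈ε → ≡.subst (p ^ b ∣_) (*-identityʳ m)
        (model-divides (p ^ b) R model-pᵇ wx ≡.refl m xᵐ≈ε) }

  y-divides : ∀ m → wy ^ᴳ m ≈ ε → p ^ (a + c) ∣ m
  y-divides m yᵐ≈ε with c ≟ 0
  ... | yes ≡.refl = ≡.subst₂ (λ k n → p ^ k ∣ n) (≡.sym (+-identityʳ a)) (*-identityʳ m)
                       (model-divides (p ^ a) R model-pᵃ wy ≡.refl m yᵐ≈ε)
  ... | no c≢0 = coprime-divisor pᵃ⁺ᶜ⊥e (≡.subst (p ^ (a + c) ∣_) (*-comm m e) pᵃ⁺ᶜ∣me)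
    where
    -- for c > 0 the unit e is prime to p
    pᵃ⁺ᶜ⊥e : Coprime (p ^ (a + c)) e
    pᵃ⁺ᶜ⊥e = Coprimality.sym (Arithmetic.prime∤⇒coprime-pow p-prime
      (Arithmetic.coprime-pow⇒∤ {k = pred c} p-prime
        (≡.subst (λ k → Coprime e (p ^ k)) (≡.sym (suc-pred c {{≢-nonZero c≢0}})) e⊥pᶜ)) (a + c))
    pᵃ⁺ᶜ∣me : p ^ (a + c) ∣ m * e
    pᵃ⁺ᶜ∣me = *-cancelʳ-∣ (p ^ Q) {{m^n≢0 p Q}} (≡.subst₂ _∣_ pᵇ-split (≡.sym (*-assoc m e (p ^ Q)))
                (model-divides (p ^ b) R model-pᵇ wy ≡.refl m yᵐ≈ε))

  y-period : HasPeriod wy (p ^ (a + c))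
  y-period = record { annihilates = y-relation ; divides-trivial = y-divides }

-- If G is abelian of exponent N, then
-- powering by s prime to N (inverted by powering by s⁻¹ mod N) and inversion
-- are automorphisms; hence (G, xʲ, yʲ) ≅ (G, x, y) for every j prime to N.
module AbelianWilson (G : Group 0ℓ 0ℓ) (comm : ∀ g h → Commutation.Commutes G g h)
                     (N : ℕ) .{{_ : NonZero N}}
                     (exponent : ∀ g → Group._≈_ G (pow G g N) (Group.ε G)) where
  open Group G
  open PowerLaws G
  open Commutation.Abelian G comm
  open Homomorphisms G G
  open import Algebra.Properties.Group G using (ε⁻¹≈ε; ⁻¹-involutive)
  open import Data.Integer using (-[1+_]; ∣_∣)

  power-hom : ∀ k → IsGroupHomomorphism (_^ᴳ k)
  power-hom k =
    mkGroupHomomorphism (_^ᴳ k) (pow-cong k) (λ g h → pow-∙ g h k) (pow-ε k) (λ g → pow-⁻¹ g k)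

  inversion-hom : IsGroupHomomorphism _⁻¹
  inversion-hom = mkGroupHomomorphism _⁻¹ ⁻¹-cong ⁻¹-homo-∙ ε⁻¹≈ε (λ _ → refl)

  power-triple : ∀ {s} → Coprime s N → ∀ x y → TripleIso G (x ^ᴳ s) (y ^ᴳ s) G x y
  power-triple {s} s⊥N x y =
    (_^ᴳ k) , inverse⇒isomorphism (power-hom k) (pow-cong s) undo-s undo-k , undo-s x , undo-s y
    where
    k : ℕ
    k = proj₁ (Arithmetic.modular-inverse N s⊥N)
    sk≡1 : (s * k) % N ≡ 1 % N
    sk≡1 = proj₂ (Arithmetic.modular-inverse N s⊥N)
    undo-s : ∀ g → (g ^ᴳ s) ^ᴳ k ≈ g
    undo-s g = pow-inverse g N (exponent g) s k sk≡1
    undo-k : ∀ g → (g ^ᴳ k) ^ᴳ s ≈ g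
    undo-k g = pow-inverse g N (exponent g) k s (≡.trans (≡.cong (_% N) (*-comm k s)) sk≡1)

  inversion-triple : ∀ x y → TripleIso G (x ⁻¹) (y ⁻¹) G x y
  inversion-triple x y =
    _⁻¹ , inverse⇒isomorphism inversion-hom ⁻¹-cong ⁻¹-involutive ⁻¹-involutive
    , ⁻¹-involutive x , ⁻¹-involutive y

  wilson-triple : ∀ j → Coprime ∣ j ∣ N → ∀ x y → TripleIso G (powℤ G x j) (powℤ G y j) G x y
  wilson-triple (+ s)    s⊥N x y = power-triple s⊥N x y
  wilson-triple -[1+ n ] s⊥N x y =
    triple-trans {G} {G} {G} (inversion-triple (x ^ᴳ suc n) (y ^ᴳ suc n)) (power-triple s⊥N x y)

-- 𝒜(p; a, b, c, e) is invariant under every Wilson operation: its group is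
-- abelian of exponent pᵇ = o(x).
A-wilson-invariant : ∀ p a b c e → Prime p → a + c ≤ b → Coprime e (p ^ c) →
  WilsonInvariant (𝒜 p a b c e)
A-wilson-invariant p a b c e p-prime a+c≤b e⊥pᶜ j j-admissible _ =
  wilson-triple j (admissible⇒coprime {j = j} x-period j-admissible) wx wy
  where
  open AGroup p a b c e
  open AOrders p a b c e p-prime a+c≤b e⊥pᶜ using (x-period)
  open Periods G using (admissible⇒coprime)
  open import Data.Nat.Properties using (m^n≢0)
  open import Data.Nat.Primality using (prime⇒nonZero)
  instance
    pᵇ≢0 : NonZero (p ^ b)
    pᵇ≢0 = m^n≢0 p b {{prime⇒nonZero p-prime}}
  open AbelianWilson G abelian (p ^ b) (exponent a+c≤b)

-- c is an orbit invariant: if H_{i,j}(𝒜(p;a,b,c₁,e₁)) ≅ 𝒜(p;a,b,c₂,e₂), the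
-- isomorphism carries yʲ, which has the same period p^{a+c₁} as y, to y.
orbit⇒same-c : ∀ p a b c₁ e₁ c₂ e₂ → Prime p →
  a + c₁ ≤ b → Coprime e₁ (p ^ c₁) → a + c₂ ≤ b → Coprime e₂ (p ^ c₂) →
  ∀ i j → HImageIso i j (𝒜 p a b c₁ e₁) (𝒜 p a b c₂ e₂) → c₁ ≡ c₂
orbit⇒same-c p a b c₁ e₁ c₂ e₂ p-prime a+c₁≤b e₁⊥pᶜ¹ a+c₂≤b e₂⊥pᶜ² i j
             (_ , j-admissible , f , f-iso , _ , f-yʲ≈y) =
  +-cancelˡ-≡ a c₁ c₂ (Arithmetic.^-injective (Arithmetic.prime>1 p-prime) same-period)
  where
  open import Data.Nat.Properties using (+-cancelˡ-≡)
  G₁ G₂ : Group 0ℓ 0ℓ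
  G₁ = Presentation.group (A-relations p a b c₁ e₁)
  G₂ = Presentation.group (A-relations p a b c₂ e₂)

  y₁-period : Periods.HasPeriod G₁ wy (p ^ (a + c₁))
  y₁-period = AOrders.y-period p a b c₁ e₁ p-prime a+c₁≤b e₁⊥pᶜ¹

  y₂-period : Periods.HasPeriod G₂ wy (p ^ (a + c₂))
  y₂-period = AOrders.y-period p a b c₂ e₂ p-prime a+c₂≤b e₂⊥pᶜ²

  yʲ-period : Periods.HasPeriod G₁ (powℤ G₁ wy j) (p ^ (a + c₁))
  yʲ-period = Periods.period-powℤ G₁ j y₁-period
    (Periods.admissible⇒coprime G₁ {j = j} y₁-period j-admissible)

  same-period : p ^ (a + c₁) ≡ p ^ (a + c₂)
  same-period = Periods.period-unique G₂
    (Periods.period-resp G₂ f-yʲ≈y (period-monomorphism G₁ G₂ isGroupMonomorphism yʲ-period))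
    y₂-period
    where open GroupMorphisms.IsGroupIsomorphism f-iso using (isGroupMonomorphism)

-- Shearing y: if e₁ j ≡ e₂ (mod pᶜ) and j k ≡ 1 (mod pᵇ), then the
-- substitutions y ↦ yᵏ and y ↦ yʲ are mutually inverse homomorphisms between
-- the groups of 𝒜(p;a,b,c,e₁) and 𝒜(p;a,b,c,e₂); the first sends (x, yʲ) to (x, y).
shear-triple : ∀ p a b c e₁ e₂ j k → a + c ≤ b →
  .{{_ : NonZero (p ^ b)}} → .{{_ : NonZero (p ^ c)}} →
  (e₁ * j) % p ^ c ≡ e₂ % p ^ c → (j * k) % p ^ b ≡ 1 % p ^ b →
  let G₁ = Presentation.group (A-relations p a b c e₁)
      G₂ = Presentation.group (A-relations p a b c e₂) in
  TripleIso G₁ (powℤ G₁ wx (+ 1)) (powℤ G₁ wy (+ j)) G₂ wx wy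
shear-triple p a b c e₁ e₂ j k a+c≤b e₁j≡e₂ jk≡1 =
  evalWord G₂ wx (pow G₂ wy k) , iso , G₂.identityʳ wx , y↦y
  where
  open import Data.Nat.Properties using (m+n≤o⇒n≤o)
  R₁ R₂ : List (Word × Word)
  R₁ = A-relations p a b c e₁
  R₂ = A-relations p a b c e₂

  G₁ G₂ : Group 0ℓ 0ℓ
  G₁ = Presentation.group R₁
  G₂ = Presentation.group R₂
  module G₁ = Group G₁
  module G₂ = Group G₂

  c≤b : c ≤ b
  c≤b = m+n≤o⇒n≤o a a+c≤b

  e₂k≡e₁ : (e₂ * k) % p ^ c ≡ e₁ % p ^ c
  e₂k≡e₁ = Arithmetic.cancel-multiplier (p ^ c) e₁j≡e₂
    (Arithmetic.%-divisor (p ^ c) (p ^ b) (Arithmetic.pow-∣ p c≤b) jk≡1)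

  y↦y : evalWord G₂ wx (pow G₂ wy k) (pow G₁ wy j) G₂.≈ wy
  y↦y = G₂.trans (G₂.reflexive (Presented.evalWord-pow R₁ G₂ wx (pow G₂ wy k) wy j))
    (PowerLaws.pow-inverse G₂ wy (p ^ b) (AGroup.exponent p a b c e₂ a+c≤b wy) k j
      (≡.trans (≡.cong (_% p ^ b) (*-comm k j)) jk≡1))

  y↦y' : evalWord G₁ wx (pow G₁ wy j) (pow G₂ wy k) G₁.≈ wy
  y↦y' = G₁.trans (G₁.reflexive (Presented.evalWord-pow R₂ G₁ wx (pow G₁ wy j) wy k))
    (PowerLaws.pow-inverse G₁ wy (p ^ b) (AGroup.exponent p a b c e₁ a+c≤b wy) j k jk≡1)

  iso : Homomorphisms.IsGroupIsomorphism G₁ G₂ (evalWord G₂ wx (pow G₂ wy k))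
  iso = presentation-iso R₁ R₂
    (AGroup.sheared-satisfies p a b c e₂ c≤b k e₁ e₂k≡e₁)
    (AGroup.sheared-satisfies p a b c e₁ c≤b j e₂ e₁j≡e₂)
    G₂.refl y↦y G₁.refl y↦y'

-- Conversely, for equal c the operation H_{1,j} with j ≡ e₂/e₁ (mod pᶜ) prime
-- to p maps 𝒜(p;a,b,c,e₁) to 𝒜(p;a,b,c,e₂).
same-c⇒orbit : ∀ p a b c e₁ e₂ → Prime p → a + c ≤ b →
  Coprime e₁ (p ^ c) → Coprime e₂ (p ^ c) → SameOrbit (𝒜 p a b c e₁) (𝒜 p a b c e₂)
same-c⇒orbit p a b c e₁ e₂ p-prime a+c≤b e₁⊥pᶜ e₂⊥pᶜ =
  + 1 , + j , inj₁ (x-admissible , y-admissible ,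
                    shear-triple p a b c e₁ e₂ j k a+c≤b e₁j≡e₂ jk≡1)
  where
  open import Data.Sum using (inj₁)
  open import Relation.Nullary using (¬_)
  open import Data.Nat.Properties using (m^n>0; m^n≢0)
  open import Data.Nat.Coprimality using (1-coprimeTo)
  open import Data.Nat.Primality using (prime⇒nonZero)
  instance
    p≢0 : NonZero p
    p≢0 = prime⇒nonZero p-prime
    pᵇ≢0 : NonZero (p ^ b)
    pᵇ≢0 = m^n≢0 p b
    pᶜ≢0 : NonZero (p ^ c)
    pᶜ≢0 = m^n≢0 p c

  ratio : ∃ λ j → (e₁ * j) % p ^ c ≡ e₂ % p ^ c × ¬ p ∣ j
  ratio = Arithmetic.unit-ratio c p-prime e₁⊥pᶜ e₂⊥pᶜ

  j : ℕ
  j = proj₁ ratio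

  e₁j≡e₂ : (e₁ * j) % p ^ c ≡ e₂ % p ^ c
  e₁j≡e₂ = proj₁ (proj₂ ratio)

  j⊥pⁿ : ∀ n → Coprime j (p ^ n)
  j⊥pⁿ = Arithmetic.prime∤⇒coprime-pow p-prime (proj₂ (proj₂ ratio))

  inverse : ∃ λ k → (j * k) % p ^ b ≡ 1 % p ^ b
  inverse = Arithmetic.modular-inverse (p ^ b) (j⊥pⁿ b)

  k : ℕ
  k = proj₁ inverse

  jk≡1 : (j * k) % p ^ b ≡ 1 % p ^ b
  jk≡1 = proj₂ inverse

  G₁ : Group 0ℓ 0ℓ
  G₁ = Presentation.group (A-relations p a b c e₁)

  x-admissible : CoprimeToOrder G₁ wx (+ 1)
  x-admissible = p ^ b , Periods.period⇒order G₁ (m^n>0 p b)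
    (AOrders.x-period p a b c e₁ p-prime a+c≤b e₁⊥pᶜ) , 1-coprimeTo (p ^ b)

  y-admissible : CoprimeToOrder G₁ wy (+ j)
  y-admissible = p ^ (a + c) , Periods.period⇒order G₁ (m^n>0 p (a + c))
    (AOrders.y-period p a b c e₁ p-prime a+c≤b e₁⊥pᶜ) , j⊥pⁿ (a + c)

parameters-fit : ∀ {a b c} → a ≤ b → c ≤ b ∸ a → a + c ≤ b
parameters-fit {a} {b} {c} a≤b c≤b∸a =
  ≡.subst (_≤ b) (+-comm c a) (m≤o∸n⇒m+n≤o c a≤b c≤b∸a)
  where open import Data.Nat.Properties using (m≤o∸n⇒m+n≤o)

corollary4p8 : ∀ (p a b : ℕ) → Prime p → a ≤ b →
    ∀ (c₁ e₁ c₂ e₂ : ℕ) →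
    c₁ ≤ b ∸ a → e₁ < p ^ c₁ → Coprime e₁ (p ^ c₁) →
    c₂ ≤ b ∸ a → e₂ < p ^ c₂ → Coprime e₂ (p ^ c₂) →
    (SameOrbit (𝒜 p a b c₁ e₁) (𝒜 p a b c₂ e₂) ⇔ (c₁ ≡ c₂))
    × WilsonInvariant (𝒜 p a b c₁ e₁)
corollary4p8 p a b p-prime a≤b c₁ e₁ c₂ e₂ c₁≤b∸a _ e₁⊥pᶜ¹ c₂≤b∸a _ e₂⊥pᶜ² =
  mk⇔ orbit⇒c₁≡c₂ c₁≡c₂⇒orbit , A-wilson-invariant p a b c₁ e₁ p-prime a+c₁≤b e₁⊥pᶜ¹
  where
  open import Function.Bundles using (mk⇔)
  open import Data.Sum using (inj₁; inj₂)
  a+c₁≤b : a + c₁ ≤ b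
  a+c₁≤b = parameters-fit a≤b c₁≤b∸a

  a+c₂≤b : a + c₂ ≤ b
  a+c₂≤b = parameters-fit a≤b c₂≤b∸a

  orbit⇒c₁≡c₂ : SameOrbit (𝒜 p a b c₁ e₁) (𝒜 p a b c₂ e₂) → c₁ ≡ c₂
  orbit⇒c₁≡c₂ (i , j , inj₁ image≅) =
    orbit⇒same-c p a b c₁ e₁ c₂ e₂ p-prime a+c₁≤b e₁⊥pᶜ¹ a+c₂≤b e₂⊥pᶜ² i j image≅
  orbit⇒c₁≡c₂ (i , j , inj₂ image≅) =
    ≡.sym (orbit⇒same-c p a b c₂ e₂ c₁ e₁ p-prime a+c₂≤b e₂⊥pᶜ² a+c₁≤b e₁⊥pᶜ¹ i j image≅)

  c₁≡c₂⇒orbit : c₁ ≡ c₂ → SameOrbit (𝒜 p a b c₁ e₁) (𝒜 p a b c₂ e₂)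
  c₁≡c₂⇒orbit ≡.refl = same-c⇒orbit p a b c₁ e₁ e₂ p-prime a+c₁≤b e₁⊥pᶜ¹ e₂⊥pᶜ²
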